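{- Let $\mathsf{JL}$ be a justification logic, $\mathcal{CS}$ a constant specification for $\mathsf{JL}$, and $\Gamma$ a maximally $\mathsf{JL}_{\mathcal{CS}}$-consistent set. Then the canonical model $\mathcal M=(\mathcal E,\mathcal V)$ with respect to $\Gamma$ is a $\mathsf{JL}_{\mathcal{CS}}$-model.
   Context: Language. Justification terms are built from justification variables and constants using binary $\cdot,+$ and unary $!,\bar?,?$. Formulas: $A ::= p \mid \bot \mid \neg A \mid A\to A \mid t:A$, $p$ from a countable set $\mathcal P$ of propositional variables. Logics. $\mathsf J$ has axiom schemes: all propositional tautologies; $s:A\to(s+t):A$, $s:A\to(t+s):A$; $s:(A\to B)\to(t:A\to(s\cdot t):B)$. Further schemes: jT: $t:A\to A$; jD: $t:\bot\to\bot$; j4: $t:A\to\,!t:t:A$; jB: $\neg A\to\bar{?}t:\neg t:A$; j5: $\neg t:A\to ?t:\neg t:A$. A justification logic $\mathsf{JL}$ is $\mathsf J$ plus any combination of these; its language contains $\cdot,+$ and those of $!,\bar?,?$ occurring in its axioms; $Tm_{\mathsf{JL}},Fm_{\mathsf{JL}}$ are its terms and formulas. A constant specification $\mathcal{CS}$ for $\mathsf{JL}$ is a downward closed set of formulas $c_{i_n}:\dots:c_{i_1}:A$ ($n\ge1$, constants $c_{i_j}$, $A$ an axiom instance of $\mathsf{JL}$): if $c_{i_n}:c_{i_{n-1}}:\dots:c_{i_1}:A\in\mathcal{CS}$, $n\ge2$, then $c_{i_{n-1}}:\dots:c_{i_1}:A\in\mathcal{CS}$. Models. A $\mathsf{JL}_{\mathcal{CS}}$-model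 is $\mathcal M=(\mathcal E,\mathcal V)$, $\mathcal V:\mathcal P\to\{0,1\}$, $\mathcal E:Tm_{\mathsf{JL}}\to2^{Fm_{\mathsf{JL}}}$ with: (E1) $A\to B\in\mathcal E(s)$, $A\in\mathcal E(t)$ imply $B\in\mathcal E(s\cdot t)$; (E2) $\mathcal E(s)\cup\mathcal E(t)\subseteq\mathcal E(s+t)$; (E3) $c:F\in\mathcal{CS}$ implies $F\in\mathcal E(c)$; if jD: (E4) $\bot\notin\mathcal E(t)$ for all $t$; if j4: (E5) $A\in\mathcal E(t)\Rightarrow t:A\in\mathcal E(!t)$; if jB: (E6) $\mathcal M\not\Vdash A\Rightarrow\neg t:A\in\mathcal E(\bar?t)$; if j5: (E7) $A\notin\mathcal E(t)\Rightarrow\neg t:A\in\mathcal E(?t)$. Forcing: $\mathcal M\not\Vdash\bot$; $\mathcal M\Vdash p$ iff $\mathcal V(p)=1$; $\neg,\to$ classical; $\mathcal M\Vdash t:A$ iff $A\in\mathcal E(t)$ (without jT), resp. iff $A\in\mathcal E(t)$ and $\mathcal M\Vdash A$ (with jT). $\mathsf{JL}_{\mathcal{CS}}$-tableaux. A tableau for a finite set $S$ starts with a single branch of the formulas of $S$ and is extended by rule applications whose premises lie on the extended branch. Rules: $(F\neg)$: $\neg\neg A$ / $A$; $(F\to)$: $\neg(A\to B)$ / $A,\neg B$; $(T\to)$: $A\to B$ / $\neg A$ | $B$; $(F+)$: $\neg(t+s):A$ / $\neg t:A,\neg s:A$; $(F\cdot)$: $\neg(s\cdot t):B$ / $\neg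 s:(A\to B)$ | $\neg t:A$ for any formula $A$. Additionally: with jT, $(T:)$: $t:A$ / $A$; with jD, $(F:_\bot)$: add $\neg t:\bot$ for any term $t$; with j4, $(F!)$: $\neg!t:t:A$ / $\neg t:A$; with jB, $(F\bar?)$: $\neg\bar?t:\neg t:A$ / $A$; with j5, $(F?)$: $\neg?t:\neg t:A$ / $t:A$. A branch closes if it contains $A$ and $\neg A$, or $\bot$, or $\neg c:F$ with $c:F\in\mathcal{CS}$; a tableau is closed if all branches close. $\Gamma$ is $\mathsf{JL}_{\mathcal{CS}}$-consistent if no finite subset has a closed $\mathsf{JL}_{\mathcal{CS}}$-tableau; maximally consistent if moreover it has no proper consistent extension. Canonical model. For a maximally $\mathsf{JL}_{\mathcal{CS}}$-consistent $\Gamma$: $\mathcal E(t)=\{A\mid\neg t:A\notin\Gamma\}$ and $\mathcal V(p)=1$ iff $p\in\Gamma$. -}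

module Defs where

open import Data.Bool using (Bool; true; false; T; not; _∨_)
open import Data.Nat using (ℕ)
open import Data.List using (List; _∷_)
open import Data.List.Membership.Propositional using (_∈_)
open import Data.List.Relation.Unary.All using (All)
open import Data.Product using (_×_)
open import Data.Unit using (⊤)
open import Relation.Nullary using (¬_)
open import Relation.Binary.PropositionalEquality using (_≡_)

-- A justification logic JL = J plus any combination of jT, jD, j4, jB, j5

record Logic : Set where
  field
    hasT hasD has4 hasB has5 : Bool
open Logic public

data Tm (L : Logic) : Set where
  jvar : ℕ → Tm L
  cst  : ℕ → Tm L
  _·_  : Tm L → Tm L → Tm L
  _+_  : Tm L → Tm L → Tm L
  bang : T (has4 L) → Tm L → Tm L
  qbar : T (hasB L) → Tm L → Tm L
  qmark : T (has5 L) → Tm L → Tm L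

infixl 7 _·_
infixl 6 _+_

data Fm (L : Logic) : Set where
  var  : ℕ → Fm L
  fls  : Fm L
  ~_   : Fm L → Fm L
  _⇒_  : Fm L → Fm L → Fm L
  _∶_  : Tm L → Fm L → Fm L

infixr 5 _⇒_
infix 6 _∶_
infix 7 ~_

eval : {L : Logic} → (Fm L → Bool) → Fm L → Bool
eval v (var p) = v (var p)
eval v fls = false
eval v (~ A) = not (eval v A)
eval v (A ⇒ B) = not (eval v A) ∨ eval v B
eval v (t ∶ A) = v (t ∶ A)

Tautology : {L : Logic} → Fm L → Set
Tautology A = ∀ v → eval v A ≡ true

data Axiom (L : Logic) : Fm L → Set where
  ax-taut : ∀ {A} → Tautology A → Axiom L A
  ax-sumˡ : ∀ {s t A} → Axiom L (s ∶ A ⇒ (s + t) ∶ A)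
  ax-sumʳ : ∀ {s t A} → Axiom L (s ∶ A ⇒ (t + s) ∶ A)
  ax-app  : ∀ {s t A B} → Axiom L (s ∶ (A ⇒ B) ⇒ (t ∶ A ⇒ (s · t) ∶ B))
  ax-jT   : T (hasT L) → ∀ {t A} → Axiom L (t ∶ A ⇒ A)
  ax-jD   : T (hasD L) → ∀ {t} → Axiom L (t ∶ fls ⇒ fls)
  ax-j4   : (p : T (has4 L)) → ∀ {t A} → Axiom L (t ∶ A ⇒ bang p t ∶ (t ∶ A))
  ax-jB   : (p : T (hasB L)) → ∀ {t A} → Axiom L (~ A ⇒ qbar p t ∶ (~ (t ∶ A)))
  ax-j5   : (p : T (has5 L)) → ∀ {t A} → Axiom L (~ (t ∶ A) ⇒ qmark p t ∶ (~ (t ∶ A)))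

data CSShape (L : Logic) : Fm L → Set where
  cs-base : ∀ {c A} → Axiom L A → CSShape L (cst c ∶ A)
  cs-step : ∀ {c F} → CSShape L F → CSShape L (cst c ∶ F)

record IsCS (L : Logic) (CS : Fm L → Set) : Set where
  field
    shape    : ∀ {F} → CS F → CSShape L F
    downward : ∀ {c F} → CS (cst c ∶ F) → CSShape L F → CS F

-- JL_CS-tableaux.  Closed L CS B : the branch B (a finite list of
-- formulas) can be extended by rule applications to a closed tableau.

data Closed (L : Logic) (CS : Fm L → Set) (B : List (Fm L)) : Set where
  cl-clash : ∀ {A} → A ∈ B → ~ A ∈ B → Closed L CS B
  cl-bot   : fls ∈ B → Closed L CS B
  cl-cs    : ∀ {c F} → CS (cst c ∶ F) → ~ (cst c ∶ F) ∈ B → Closed L CS B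
  r-F¬ : ∀ {A} → ~ ~ A ∈ B → Closed L CS (A ∷ B) → Closed L CS B
  r-F⇒ : ∀ {A C} → ~ (A ⇒ C) ∈ B → Closed L CS (~ C ∷ A ∷ B) → Closed L CS B
  r-T⇒ : ∀ {A C} → (A ⇒ C) ∈ B → Closed L CS (~ A ∷ B) → Closed L CS (C ∷ B)
         → Closed L CS B
  r-F+ : ∀ {t s A} → ~ ((t + s) ∶ A) ∈ B → Closed L CS (~ (s ∶ A) ∷ ~ (t ∶ A) ∷ B)
         → Closed L CS B
  r-F· : ∀ {s t C} → ~ ((s · t) ∶ C) ∈ B → (A : Fm L)
         → Closed L CS (~ (s ∶ (A ⇒ C)) ∷ B) → Closed L CS (~ (t ∶ A) ∷ B)
         → Closed L CS B
  r-T∶ : T (hasT L) → ∀ {t A} → t ∶ A ∈ B → Closed L CS (A ∷ B) → Closed L CS B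
  r-F∶⊥ : T (hasD L) → (t : Tm L) → Closed L CS (~ (t ∶ fls) ∷ B) → Closed L CS B
  r-F! : (p : T (has4 L)) → ∀ {t A} → ~ (bang p t ∶ (t ∶ A)) ∈ B
         → Closed L CS (~ (t ∶ A) ∷ B) → Closed L CS B
  r-F?̄ : (p : T (hasB L)) → ∀ {t A} → ~ (qbar p t ∶ (~ (t ∶ A))) ∈ B
         → Closed L CS (A ∷ B) → Closed L CS B
  r-F? : (p : T (has5 L)) → ∀ {t A} → ~ (qmark p t ∶ (~ (t ∶ A))) ∈ B
         → Closed L CS (t ∶ A ∷ B) → Closed L CS B

Consistent : (L : Logic) → (Fm L → Set) → (Fm L → Set) → Set
Consistent L CS Γ = ∀ (S : List (Fm L)) → All Γ S → ¬ Closed L CS S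

MaxConsistent : (L : Logic) → (Fm L → Set) → (Fm L → Set) → Set₁
MaxConsistent L CS Γ =
  Consistent L CS Γ ×
  (∀ (Δ : Fm L → Set) → (∀ {A} → Γ A → Δ A) → Consistent L CS Δ → ∀ {A} → Δ A → Γ A)

record Model (L : Logic) : Set₁ where
  field
    E : Tm L → Fm L → Set
    V : ℕ → Set
open Model public

IfT : Bool → Set → Set
IfT true X = X
IfT false X = ⊤

_⊩_ : {L : Logic} → Model L → Fm L → Set
M ⊩ var p = V M p
M ⊩ fls = Data.Empty.⊥
  where import Data.Empty
M ⊩ (~ A) = ¬ (M ⊩ A)
M ⊩ (A ⇒ B) = M ⊩ A → M ⊩ B
_⊩_ {L} M (t ∶ A) = E M t A × IfT (hasT L) (M ⊩ A)

record IsModel (L : Logic) (CS : Fm L → Set) (M : Model L) : Set where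
  field
    E1 : ∀ {s t A B} → E M s (A ⇒ B) → E M t A → E M (s · t) B
    E2ˡ : ∀ {s t A} → E M s A → E M (s + t) A
    E2ʳ : ∀ {s t A} → E M t A → E M (s + t) A
    E3 : ∀ {c F} → CS (cst c ∶ F) → E M (cst c) F
    E4 : T (hasD L) → ∀ t → ¬ E M t fls
    E5 : (p : T (has4 L)) → ∀ {t A} → E M t A → E M (bang p t) (t ∶ A)
    E6 : (p : T (hasB L)) → ∀ {t A} → ¬ (M ⊩ A) → E M (qbar p t) (~ (t ∶ A))
    E7 : (p : T (has5 L)) → ∀ {t A} → ¬ E M t A → E M (qmark p t) (~ (t ∶ A))

canonical : {L : Logic} → (Fm L → Set) → Model L
canonical Γ = record { E = λ t A → ¬ Γ (~ (t ∶ A)) ; V = λ p → Γ (var p) }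

-- Maximality makes Γ closed under the tableau rules: if X ∉ Γ then (up to double
-- negation) X together with finitely many members of Γ has a closed tableau, so a
-- rule deriving X from members of Γ, or a branching rule with both branch
-- formulas outside Γ, would close a tableau for a finite subset of Γ.  Each of
-- E1–E7 is an instance of this; E6 also needs the truth lemma, which here holds
-- in the double-negated form  A ∈ Γ ⇒ ¬¬ M ⊩ A  and  ~A ∈ Γ ⇒ M ⊮ A.

module Submission where

open import Defs
open import Data.Bool using (true; false; T)
open import Data.Empty using (⊥; ⊥-elim)
open import Data.Unit using (tt)
open import Data.List using (List; []; _∷_; _++_; [_])
open import Data.List.Relation.Binary.Subset.Propositional using (_⊆_)
open import Data.List.Relation.Binary.Subset.Propositional.Properties
  using (xs⊆x∷xs; ∷⁺ʳ; xs⊆xs++ys; xs⊆ys++xs; ⊆-trans)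
open import Data.List.Relation.Unary.Any using (here; there)
open import Data.List.Relation.Unary.All using (All; []; _∷_)
open import Data.List.Relation.Unary.All.Properties using (++⁺)
open import Data.Product using (Σ; _×_; _,_; proj₁; proj₂)
open import Data.Sum using (_⊎_; inj₁; inj₂)
open import Relation.Nullary using (¬_)
open import Relation.Binary.PropositionalEquality using (_≡_; refl)

Closed-mono : ∀ {L CS} {B B′ : List (Fm L)} → B ⊆ B′ → Closed L CS B → Closed L CS B′
Closed-mono s (cl-clash a b) = cl-clash (s a) (s b)
Closed-mono s (cl-bot a) = cl-bot (s a)
Closed-mono s (cl-cs c a) = cl-cs c (s a)
Closed-mono s (r-F¬ a c) = r-F¬ (s a) (Closed-mono (∷⁺ʳ _ s) c)
Closed-mono s (r-F⇒ a c) = r-F⇒ (s a) (Closed-mono (∷⁺ʳ _ (∷⁺ʳ _ s)) c)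
Closed-mono s (r-T⇒ a c d) = r-T⇒ (s a) (Closed-mono (∷⁺ʳ _ s) c) (Closed-mono (∷⁺ʳ _ s) d)
Closed-mono s (r-F+ a c) = r-F+ (s a) (Closed-mono (∷⁺ʳ _ (∷⁺ʳ _ s)) c)
Closed-mono s (r-F· a A c d) = r-F· (s a) A (Closed-mono (∷⁺ʳ _ s) c) (Closed-mono (∷⁺ʳ _ s) d)
Closed-mono s (r-T∶ p a c) = r-T∶ p (s a) (Closed-mono (∷⁺ʳ _ s) c)
Closed-mono s (r-F∶⊥ p t c) = r-F∶⊥ p t (Closed-mono (∷⁺ʳ _ s) c)
Closed-mono s (r-F! p a c) = r-F! p (s a) (Closed-mono (∷⁺ʳ _ s) c)
Closed-mono s (r-F?̄ p a c) = r-F?̄ p (s a) (Closed-mono (∷⁺ʳ _ s) c)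
Closed-mono s (r-F? p a c) = r-F? p (s a) (Closed-mono (∷⁺ʳ _ s) c)

¬¬-IfT : ∀ {X : Set} b → (T b → ¬ ¬ X) → ¬ ¬ IfT b X
¬¬-IfT true f = f tt
¬¬-IfT false f k = k tt

module MaxConsistentSet {L : Logic} {CS : Fm L → Set} {Γ : Fm L → Set}
                        (mc : MaxConsistent L CS Γ) where

  Refutation : Fm L → Set
  Refutation X = Σ (List (Fm L)) λ B → All Γ B × Closed L CS (X ∷ B)

  ¬Closed : ∀ {B} → All Γ B → ¬ Closed L CS B
  ¬Closed {B} = proj₁ mc B

  ¬clash : ∀ {A} → Γ A → Γ (~ A) → ⊥
  ¬clash gA g¬A = ¬Closed (gA ∷ g¬A ∷ []) (cl-clash (here refl) (there (here refl)))

  ∈-if-unrefuted : ∀ {X} → ¬ Refutation X → Γ X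
  ∈-if-unrefuted {X} ¬ref = proj₂ mc (λ A → Γ A ⊎ A ≡ X) inj₁ consistent (inj₂ refl)
    where
    separate : ∀ B → All (λ A → Γ A ⊎ A ≡ X) B → Σ (List (Fm L)) λ B′ → All Γ B′ × B ⊆ X ∷ B′
    separate [] [] = [] , [] , λ ()
    separate (A ∷ B) (inj₁ gA ∷ gB) with separate B gB
    ... | B′ , gB′ , s = A ∷ B′ , gA ∷ gB′ , λ { (here refl) → there (here refl)
                                               ; (there a) → ∷⁺ʳ X (xs⊆x∷xs B′ A) (s a) }
    separate (A ∷ B) (inj₂ refl ∷ gB) with separate B gB
    ... | B′ , gB′ , s = B′ , gB′ , λ { (here refl) → here refl ; (there a) → s a }

    consistent : Consistent L CS (λ A → Γ A ⊎ A ≡ X)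
    consistent B gB c with separate B gB
    ... | B′ , gB′ , s = ¬ref (B′ , gB′ , Closed-mono s c)

  ∉⇒¬¬Refutation : ∀ {X} → ¬ Γ X → ¬ ¬ Refutation X
  ∉⇒¬¬Refutation X∉Γ ¬ref = X∉Γ (∈-if-unrefuted ¬ref)

  ∈-by-rule : ∀ {X} P → (∀ {B} → Closed L CS (X ∷ P ++ B) → Closed L CS (P ++ B)) →
              All Γ P → Γ X
  ∈-by-rule {X} P rule gP = ∈-if-unrefuted λ (B , gB , c) →
    ¬Closed (++⁺ gP gB) (rule (Closed-mono (∷⁺ʳ X (xs⊆ys++xs B P)) c))

  ∉-by-branching-rule : ∀ {X Y} P →
    (∀ {B} → Closed L CS (X ∷ P ++ B) → Closed L CS (Y ∷ P ++ B) → Closed L CS (P ++ B)) →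
    All Γ P → ¬ Γ X → ¬ Γ Y → ⊥
  ∉-by-branching-rule {X} {Y} P rule gP X∉Γ Y∉Γ =
    ∉⇒¬¬Refutation X∉Γ λ (B₁ , gB₁ , c₁) →
    ∉⇒¬¬Refutation Y∉Γ λ (B₂ , gB₂ , c₂) →
    ¬Closed (++⁺ gP (++⁺ gB₁ gB₂))
      (rule (Closed-mono (∷⁺ʳ X (⊆-trans (xs⊆xs++ys B₁ B₂) (xs⊆ys++xs _ P))) c₁)
            (Closed-mono (∷⁺ʳ Y (⊆-trans (xs⊆ys++xs B₂ B₁) (xs⊆ys++xs _ P))) c₂))

  M : Model L
  M = canonical Γ

  ∈⇒¬¬⊩ : ∀ A → Γ A → ¬ ¬ (M ⊩ A)
  ∈~⇒⊮ : ∀ A → Γ (~ A) → ¬ (M ⊩ A)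

  ∈⇒¬¬⊩ (var p) g k = k g
  ∈⇒¬¬⊩ fls g _ = ¬Closed (g ∷ []) (cl-bot (here refl))
  ∈⇒¬¬⊩ (~ A) g k = k (∈~⇒⊮ A g)
  ∈⇒¬¬⊩ (A ⇒ C) g k = ∉-by-branching-rule [ A ⇒ C ] (r-T⇒ (here refl)) (g ∷ [])
    (λ g¬A → k λ mA → ⊥-elim (∈~⇒⊮ A g¬A mA))
    (λ gC → ∈⇒¬¬⊩ C gC λ mC → k λ _ → mC)
  ∈⇒¬¬⊩ (t ∶ A) g k = ¬¬-IfT (hasT L)
    (λ jT → ∈⇒¬¬⊩ A (∈-by-rule [ t ∶ A ] (r-T∶ jT (here refl)) (g ∷ [])))
    (λ mA → k (¬clash g , mA))

  ∈~⇒⊮ (var p) g v = ¬clash v g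
  ∈~⇒⊮ fls g ()
  ∈~⇒⊮ (~ A) g = ∈⇒¬¬⊩ A (∈-by-rule [ ~ ~ A ] (r-F¬ (here refl)) (g ∷ []))
  ∈~⇒⊮ (A ⇒ C) g f = ∈⇒¬¬⊩ A gA λ mA → ∈~⇒⊮ C g¬C (f mA)
    where
    gA : Γ A
    gA = ∈-by-rule [ ~ (A ⇒ C) ]
      (λ c → r-F⇒ (here refl) (Closed-mono (xs⊆x∷xs _ _) c)) (g ∷ [])
    g¬C : Γ (~ C)
    g¬C = ∈-by-rule [ ~ (A ⇒ C) ]
      (λ c → r-F⇒ (here refl) (Closed-mono (∷⁺ʳ _ (xs⊆x∷xs _ _)) c)) (g ∷ [])
  ∈~⇒⊮ (t ∶ A) g (A∈Et , _) = A∈Et g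

lemma4 : (L : Logic) (CS : Fm L → Set) → IsCS L CS →
    (Γ : Fm L → Set) → MaxConsistent L CS Γ →
    IsModel L CS (canonical Γ)
lemma4 L CS _ Γ mc = record
  { E1 = λ {_} {_} {A} n₁ n₂ g →
      ∉-by-branching-rule [ _ ] (r-F· (here refl) A) (g ∷ []) n₁ n₂
  ; E2ˡ = λ n g → n (∈-by-rule [ _ ]
      (λ c → r-F+ (here refl) (Closed-mono (xs⊆x∷xs _ _) c)) (g ∷ []))
  ; E2ʳ = λ n g → n (∈-by-rule [ _ ]
      (λ c → r-F+ (here refl) (Closed-mono (∷⁺ʳ _ (xs⊆x∷xs _ _)) c)) (g ∷ []))
  ; E3 = λ cs g → ¬Closed (g ∷ []) (cl-cs cs (here refl))
  ; E4 = λ jD t n → n (∈-by-rule [] (r-F∶⊥ jD t) [])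
  ; E5 = λ j4 n g → n (∈-by-rule [ _ ] (r-F! j4 (here refl)) (g ∷ []))
  ; E6 = λ jB ⊮A g → ∈⇒¬¬⊩ _ (∈-by-rule [ _ ] (r-F?̄ jB (here refl)) (g ∷ [])) ⊮A
  ; E7 = λ j5 ¬¬g g → ¬¬g (¬clash (∈-by-rule [ _ ] (r-F? j5 (here refl)) (g ∷ [])))
  }
  where open MaxConsistentSet mc
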